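{- For each $(\alpha,\beta)\in\{(2,8),(4,6),(6,4)\}$, $(\alpha,\beta)\in\mathrm{HWP}(21;3,7)$; that is, $K_{21}$ has a 2-factorization consisting of exactly $\alpha$ $C_3$-factors and $\beta$ $C_7$-factors.
   Context: A $C_k$-factor of a graph is a spanning subgraph all of whose components are cycles of length $k$. A 2-factorization is a partition of the edge set into 2-factors. $\mathrm{HWP}(v;m,n)$ is the set of pairs $(\alpha,\beta)$ such that $K_v$ ($v$ odd) or $K_v$ minus a 1-factor ($v$ even) has a 2-factorization into exactly $\alpha$ $C_m$-factors and $\beta$ $C_n$-factors. -}

module Defs where

open import Data.Nat using (ℕ; suc; NonZero)
open import Data.Nat.DivMod using (_mod_)
open import Data.Fin using (Fin; toℕ)
open import Data.Product using (Σ; Σ-syntax; _×_; _,_; proj₁; proj₂)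
open import Data.Sum using (_⊎_)
open import Function.Definitions using (Bijective)
open import Relation.Binary.PropositionalEquality using (_≡_; _≢_)

next : {k : ℕ} .{{_ : NonZero k}} → Fin k → Fin k
next {k} j = suc (toℕ j) mod k

-- A C_k-factor of K_v (vertex set Fin v): a family of `count` cycles of
-- length k, cycle i visiting the vertices  cyc i 0, cyc i 1, …, cyc i (k-1)
-- and then back to cyc i 0 (its edges are {cyc i j , cyc i (next j)}).
-- Requiring (i , j) ↦ cyc i j to be a bijection Fin count × Fin k → Fin v
-- says exactly that each cycle has k distinct vertices, the cycles are
-- pairwise vertex-disjoint, and together they span all v vertices.
-- (Cycle lengths used here are k ≥ 3, so these are genuine cycles of K_v.)
record CFactor (v k : ℕ) : Set where
  field
    count     : ℕ
    cyc       : Fin count → Fin k → Fin v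
    bijective : Bijective _≡_ _≡_ (λ (p : Fin count × Fin k) → cyc (proj₁ p) (proj₂ p))

open CFactor public

EdgeAt : {v k : ℕ} .{{_ : NonZero k}} → (Fin k → Fin v) → Fin k → Fin v → Fin v → Set
EdgeAt c j x y = (c j ≡ x × c (next j) ≡ y) ⊎ (c j ≡ y × c (next j) ≡ x)

Pos : {v m n α β : ℕ} → (Fin α → CFactor v m) → (Fin β → CFactor v n) → Set
Pos {m = m} {n = n} {α} {β} F G =
  (Σ[ a ∈ Fin α ] (Fin (count (F a)) × Fin m)) ⊎ (Σ[ b ∈ Fin β ] (Fin (count (G b)) × Fin n))

Occ : {v m n α β : ℕ} .{{_ : NonZero m}} .{{_ : NonZero n}}
      (F : Fin α → CFactor v m) (G : Fin β → CFactor v n) →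
      Pos F G → Fin v → Fin v → Set
Occ F G (Data.Sum.inj₁ (a , i , j)) x y = EdgeAt (cyc (F a) i) j x y
Occ F G (Data.Sum.inj₂ (b , i , j)) x y = EdgeAt (cyc (G b) i) j x y

record HWPFactorization (v m n α β : ℕ) .{{_ : NonZero m}} .{{_ : NonZero n}} : Set where
  field
    F       : Fin α → CFactor v m
    G       : Fin β → CFactor v n
    covered : (x y : Fin v) → x ≢ y → Σ[ p ∈ Pos F G ] Occ F G p x y
    unique  : (x y : Fin v) → x ≢ y → (p q : Pos F G) →
              Occ F G p x y → Occ F G q x y → p ≡ q

-- (α , β) ∈ HWP(v ; m , n) for v odd (the case K_v; only odd v is needed here).
InHWP : (v m n α β : ℕ) .{{_ : NonZero m}} .{{_ : NonZero n}} → Set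
InHWP v m n α β = HWPFactorization v m n α β

-- Number the
-- vertices so that 7 j + u is the point (j , u) of Z₃ × Z₇; every C₃-factor consists of
-- the seven Z₇-translates of a triangle {(0,0), (1,a), (2,b)}, and the C₇-factors are
-- listed cycle by cycle. That these form a 2-factorization is a finite check: each factor
-- labels the vertices bijectively, and recording every cycle edge at both of its
-- endpoints in a 21 × 21 table yields a table in which every edge of K₂₁ is present and
-- no cycle edge was overwritten, so every edge lies on exactly one cycle.
module Submission where

open import Defs
open import Data.Product using (_×_)
open import Data.Nat using (ℕ)

open import Agda.Builtin.FromNat using (Number; fromNat)
open import Data.Nat using (NonZero; _+_)
import Data.Nat.Literals as ℕ
open import Data.Nat.DivMod using (_mod_)
open import Data.Unit using (tt)
open import Data.Fin using (Fin; toℕ; combine)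
import Data.Fin.Literals as Fin
import Data.Fin.Properties as Fin
open import Data.List using (List)
import Data.List as List
open import Data.Maybe using (Maybe; just; nothing)
import Data.Maybe.Properties as Maybe
open import Data.Maybe.Relation.Unary.Any using (Any; just)
import Data.Maybe.Relation.Unary.Any as Maybe
open import Data.Product using (∃; _,_; proj₁; proj₂; uncurry)
import Data.Product.Properties as ×
open import Data.Sum using (_⊎_; inj₁; inj₂)
import Data.Sum.Properties as ⊎
open import Data.Vec using (Vec; []; _∷_; lookup; replicate; _[_]%=_; _[_]≔_)
open import Function.Definitions using (Bijective)
open import Function.Consequences.Propositional using (strictlySurjective⇒surjective)
open import Level using (0ℓ)
open import Relation.Binary.Definitions using (DecidableEquality)
open import Relation.Binary.PropositionalEquality using (_≡_; _≢_; refl; sym; trans)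
open import Relation.Nullary.Decidable
  using (Dec; map′; _×-dec_; _⊎-dec_; _→-dec_; ¬?; True; toWitness)
open import Relation.Unary using (Pred; Decidable)

record Searchable (A : Set) : Set₁ where
  field
    all? : {P : Pred A 0ℓ} → Decidable P → Dec (∀ x → P x)
    any? : {P : Pred A 0ℓ} → Decidable P → Dec (∃ P)

open Searchable

Fin-searchable : ∀ {n} → Searchable (Fin n)
Fin-searchable = record { all? = Fin.all? ; any? = Fin.any? }

×-searchable : {A B : Set} → Searchable A → Searchable B → Searchable (A × B)
×-searchable A B = record
  { all? = λ P? → map′ (λ h (x , y) → h x y) (λ h x y → h (x , y))
                       (all? A λ x → all? B λ y → P? (x , y))
  ; any? = λ P? → map′ (λ (x , y , p) → (x , y) , p) (λ ((x , y) , p) → x , y , p)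
                       (any? A λ x → any? B λ y → P? (x , y))
  }

⊎-searchable : {A B : Set} → Searchable A → Searchable B → Searchable (A ⊎ B)
⊎-searchable A B = record
  { all? = λ P? → map′ (λ { (h , k) (inj₁ x) → h x ; (h , k) (inj₂ y) → k y })
                       (λ h → (λ x → h (inj₁ x)) , (λ y → h (inj₂ y)))
                       (all? A (λ x → P? (inj₁ x)) ×-dec all? B (λ y → P? (inj₂ y)))
  ; any? = λ P? → map′ (λ { (inj₁ (x , p)) → inj₁ x , p ; (inj₂ (y , p)) → inj₂ y , p })
                       (λ { (inj₁ x , p) → inj₁ (x , p) ; (inj₂ y , p) → inj₂ (y , p) })
                       (any? A (λ x → P? (inj₁ x)) ⊎-dec any? B (λ y → P? (inj₂ y)))
  }

bijective? : {A B : Set} → Searchable A → Searchable B →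
             DecidableEquality A → DecidableEquality B →
             (f : A → B) → Dec (Bijective _≡_ _≡_ f)
bijective? A B _≟ᴬ_ _≟ᴮ_ f =
  map′ (λ (inj , surj) → (λ {x} {y} → inj x y) , strictlySurjective⇒surjective surj)
       (λ (inj , surj) → (λ x y → inj) , λ y → let (x , f≡y) = surj y in x , f≡y refl)
       (   all? A (λ x → all? A λ y → f x ≟ᴮ f y →-dec x ≟ᴬ y)
     ×-dec all? B (λ y → any? A λ x → f x ≟ᴮ y))

module _ {v m n α β cₘ cₙ : ℕ} .{{_ : NonZero m}} .{{_ : NonZero n}}
         (σ : Fin α → Fin cₘ → Fin m → Fin v) (τ : Fin β → Fin cₙ → Fin n → Fin v) where

  Slot : Set
  Slot = (Fin α × Fin cₘ × Fin m) ⊎ (Fin β × Fin cₙ × Fin n)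

  source target : Slot → Fin v
  source (inj₁ (a , i , j)) = σ a i j
  source (inj₂ (b , i , j)) = τ b i j
  target (inj₁ (a , i , j)) = σ a i (next j)
  target (inj₂ (b , i , j)) = τ b i (next j)

  Carries : Slot → Fin v → Fin v → Set
  Carries s x y = (source s ≡ x × target s ≡ y) ⊎ (source s ≡ y × target s ≡ x)

  carries? : ∀ s x y → Dec (Carries s x y)
  carries? s x y =   (source s Fin.≟ x ×-dec target s Fin.≟ y)
                 ⊎-dec (source s Fin.≟ y ×-dec target s Fin.≟ x)

  EdgeIndex : Set
  EdgeIndex = Vec (Vec (Maybe Slot) v) v

  record IsHWPFactorizationWith (index : EdgeIndex) : Set where
    field
      σ-bijective   : ∀ a → Bijective _≡_ _≡_ (uncurry (σ a))
      τ-bijective   : ∀ b → Bijective _≡_ _≡_ (uncurry (τ b))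
      indexes-edges : ∀ x y → x ≢ y → Any (λ s → Carries s x y) (lookup (lookup index x) y)
      indexes-slots : ∀ s → lookup (lookup index (source s)) (target s) ≡ just s
                          × lookup (lookup index (target s)) (source s) ≡ just s

  module _ {index : EdgeIndex} (h : IsHWPFactorizationWith index) where
    open IsHWPFactorizationWith h

    factorsₘ : Fin α → CFactor v m
    factorsₘ a = record { count = cₘ ; cyc = σ a ; bijective = σ-bijective a }

    factorsₙ : Fin β → CFactor v n
    factorsₙ b = record { count = cₙ ; cyc = τ b ; bijective = τ-bijective b }

    carries⇒occ : ∀ s {x y} → Carries s x y → Occ factorsₘ factorsₙ s x y
    carries⇒occ (inj₁ _) c = c
    carries⇒occ (inj₂ _) c = c

    occ⇒carries : ∀ s {x y} → Occ factorsₘ factorsₙ s x y → Carries s x y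
    occ⇒carries (inj₁ _) o = o
    occ⇒carries (inj₂ _) o = o

    carrier-indexed : ∀ {s x y} → Carries s x y → lookup (lookup index x) y ≡ just s
    carrier-indexed {s} (inj₁ (refl , refl)) = proj₁ (indexes-slots s)
    carrier-indexed {s} (inj₂ (refl , refl)) = proj₂ (indexes-slots s)

    carrier-unique : ∀ {s t x y} → Carries s x y → Carries t x y → s ≡ t
    carrier-unique cₛ cₜ = Maybe.just-injective (trans (sym (carrier-indexed cₛ)) (carrier-indexed cₜ))

    hwpFactorization : HWPFactorization v m n α β
    hwpFactorization = record
      { F       = factorsₘ
      ; G       = factorsₙ
      ; covered = λ x y x≢y → indexed-carrier (indexes-edges x y x≢y)
      ; unique  = λ _ _ _ s t oₛ oₜ → carrier-unique (occ⇒carries s oₛ) (occ⇒carries t oₜ)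
      }
      where
      indexed-carrier : ∀ {x y} {e : Maybe Slot} →
                        Any (λ s → Carries s x y) e → ∃ λ s → Occ factorsₘ factorsₙ s x y
      indexed-carrier (just {s} c) = s , carries⇒occ s c

  isHWPFactorizationWith? : ∀ index → Dec (IsHWPFactorizationWith index)
  isHWPFactorizationWith? index =
    map′ (λ (σ-bij , τ-bij , edges , slots) → record
           { σ-bijective = σ-bij ; τ-bijective = τ-bij ; indexes-edges = edges ; indexes-slots = slots })
         (λ h → let open IsHWPFactorizationWith h in
                σ-bijective , τ-bijective , indexes-edges , indexes-slots)
         (   all? Fin-searchable (λ a → bijective? cells Fin-searchable cell-≟ Fin._≟_ (uncurry (σ a)))
       ×-dec all? Fin-searchable (λ b → bijective? cells Fin-searchable cell-≟ Fin._≟_ (uncurry (τ b)))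
       ×-dec all? Fin-searchable (λ x → all? Fin-searchable λ y →
               ¬? (x Fin.≟ y) →-dec Maybe.dec (λ s → carries? s x y) (lookup (lookup index x) y))
       ×-dec all? Slot-searchable λ s →
                   indexed? (source s) (target s) s ×-dec indexed? (target s) (source s) s)
    where
    cells : ∀ {a b} → Searchable (Fin a × Fin b)
    cells = ×-searchable Fin-searchable Fin-searchable
    cell-≟ : ∀ {a b} → DecidableEquality (Fin a × Fin b)
    cell-≟ = ×.≡-dec Fin._≟_ Fin._≟_
    Slot-searchable : Searchable Slot
    Slot-searchable = ⊎-searchable (×-searchable Fin-searchable cells) (×-searchable Fin-searchable cells)
    slot-≟ : DecidableEquality Slot
    slot-≟ = ⊎.≡-dec (×.≡-dec Fin._≟_ cell-≟) (×.≡-dec Fin._≟_ cell-≟)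
    indexed? : ∀ x y s → Dec (lookup (lookup index x) y ≡ just s)
    indexed? x y s = Maybe.≡-dec slot-≟ (lookup (lookup index x) y) (just s)

  -- Nothing is proved about this table: isHWPFactorizationWith? validates whichever table
  -- it is given. Building it in one pass and handing it over as an argument (so that it is
  -- evaluated once) replaces a search over all slots for every edge by table lookups.
  edgeIndex : EdgeIndex
  edgeIndex = List.foldr record-slot (replicate v (replicate v nothing)) allSlots
    where
    triples : ∀ a b c → List (Fin a × Fin b × Fin c)
    triples a b c = List.cartesianProduct (List.allFin a)
                      (List.cartesianProduct (List.allFin b) (List.allFin c))
    allSlots : List Slot
    allSlots = List.map inj₁ (triples α cₘ m) List.++ List.map inj₂ (triples β cₙ n)
    record-slot : Slot → EdgeIndex → EdgeIndex
    record-slot s index = record-at (source s) (target s) (record-at (target s) (source s) index)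
      where
      record-at : Fin v → Fin v → EdgeIndex → EdgeIndex
      record-at x y index = index [ x ]%= λ row → row [ y ]≔ just s

checkedHWPFactorization : ∀ {v m n α β cₘ cₙ} .{{_ : NonZero m}} .{{_ : NonZero n}}
                          (σ : Fin α → Fin cₘ → Fin m → Fin v) (τ : Fin β → Fin cₙ → Fin n → Fin v) →
                          {True (isHWPFactorizationWith? σ τ (edgeIndex σ τ))} →
                          InHWP v m n α β
checkedHWPFactorization σ τ {ok} = hwpFactorization σ τ (toWitness ok)

instance
  ℕ-number : Number ℕ
  ℕ-number = ℕ.number

  Fin-number : ∀ {n} → Number (Fin n)
  Fin-number {n} = Fin.number n

translatedTriangles : ∀ {α} → Vec (Fin 7 × Fin 7) α → Fin α → Fin 7 → Fin 3 → Fin 21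
translatedTriangles shifts a u j = combine j ((toℕ u + toℕ (lookup offsets j)) mod 7)
  where
  offsets : Vec (Fin 7) 3
  offsets = 0 ∷ proj₁ (lookup shifts a) ∷ proj₂ (lookup shifts a) ∷ []

cycleTable : ∀ {v k c β} → Vec (Vec (Vec (Fin v) k) c) β → Fin β → Fin c → Fin k → Fin v
cycleTable t b i j = lookup (lookup (lookup t b) i) j

triangles28 : Vec (Fin 7 × Fin 7) 2
triangles28 = (4 , 1) ∷ (6 , 5) ∷ []

heptagons28 : Vec (Vec (Vec (Fin 21) 7) 3) 8
heptagons28 =
    ((0 ∷ 17 ∷ 3 ∷ 11 ∷ 8 ∷ 9 ∷ 6 ∷ []) ∷ (1 ∷ 15 ∷ 16 ∷ 5 ∷ 14 ∷ 12 ∷ 19 ∷ []) ∷ (2 ∷ 20 ∷ 4 ∷ 18 ∷ 10 ∷ 13 ∷ 7 ∷ []) ∷ [])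
  ∷ ((0 ∷ 2 ∷ 11 ∷ 4 ∷ 7 ∷ 8 ∷ 10 ∷ []) ∷ (1 ∷ 14 ∷ 15 ∷ 19 ∷ 9 ∷ 17 ∷ 18 ∷ []) ∷ (3 ∷ 12 ∷ 20 ∷ 6 ∷ 16 ∷ 13 ∷ 5 ∷ []) ∷ [])
  ∷ ((0 ∷ 5 ∷ 18 ∷ 9 ∷ 14 ∷ 4 ∷ 12 ∷ []) ∷ (1 ∷ 3 ∷ 2 ∷ 19 ∷ 11 ∷ 20 ∷ 8 ∷ []) ∷ (6 ∷ 13 ∷ 15 ∷ 10 ∷ 17 ∷ 16 ∷ 7 ∷ []) ∷ [])
  ∷ ((0 ∷ 7 ∷ 14 ∷ 13 ∷ 11 ∷ 6 ∷ 4 ∷ []) ∷ (1 ∷ 5 ∷ 12 ∷ 9 ∷ 16 ∷ 3 ∷ 10 ∷ []) ∷ (2 ∷ 15 ∷ 20 ∷ 19 ∷ 17 ∷ 8 ∷ 18 ∷ []) ∷ [])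
  ∷ ((0 ∷ 1 ∷ 2 ∷ 12 ∷ 10 ∷ 5 ∷ 8 ∷ []) ∷ (3 ∷ 20 ∷ 14 ∷ 11 ∷ 16 ∷ 18 ∷ 13 ∷ []) ∷ (4 ∷ 9 ∷ 7 ∷ 19 ∷ 6 ∷ 15 ∷ 17 ∷ []) ∷ [])
  ∷ ((0 ∷ 18 ∷ 14 ∷ 17 ∷ 12 ∷ 8 ∷ 3 ∷ []) ∷ (1 ∷ 9 ∷ 13 ∷ 4 ∷ 15 ∷ 7 ∷ 11 ∷ []) ∷ (2 ∷ 10 ∷ 20 ∷ 16 ∷ 19 ∷ 5 ∷ 6 ∷ []) ∷ [])
  ∷ ((0 ∷ 9 ∷ 2 ∷ 4 ∷ 3 ∷ 14 ∷ 16 ∷ []) ∷ (1 ∷ 17 ∷ 7 ∷ 5 ∷ 15 ∷ 8 ∷ 6 ∷ []) ∷ (10 ∷ 11 ∷ 12 ∷ 13 ∷ 20 ∷ 18 ∷ 19 ∷ []) ∷ [])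
  ∷ ((0 ∷ 20 ∷ 17 ∷ 6 ∷ 3 ∷ 19 ∷ 14 ∷ []) ∷ (1 ∷ 4 ∷ 5 ∷ 2 ∷ 16 ∷ 8 ∷ 13 ∷ []) ∷ (7 ∷ 10 ∷ 9 ∷ 11 ∷ 18 ∷ 15 ∷ 12 ∷ []) ∷ [])
  ∷ []

triangles46 : Vec (Fin 7 × Fin 7) 4
triangles46 = (1 , 3) ∷ (2 , 5) ∷ (4 , 4) ∷ (5 , 6) ∷ []

heptagons46 : Vec (Vec (Vec (Fin 21) 7) 3) 6
heptagons46 =
    ((0 ∷ 10 ∷ 11 ∷ 5 ∷ 8 ∷ 19 ∷ 4 ∷ []) ∷ (1 ∷ 16 ∷ 18 ∷ 15 ∷ 17 ∷ 20 ∷ 7 ∷ []) ∷ (2 ∷ 3 ∷ 13 ∷ 9 ∷ 14 ∷ 6 ∷ 12 ∷ []) ∷ [])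
  ∷ ((0 ∷ 7 ∷ 11 ∷ 8 ∷ 14 ∷ 5 ∷ 1 ∷ []) ∷ (2 ∷ 17 ∷ 16 ∷ 10 ∷ 12 ∷ 18 ∷ 4 ∷ []) ∷ (3 ∷ 9 ∷ 15 ∷ 20 ∷ 19 ∷ 13 ∷ 6 ∷ []) ∷ [])
  ∷ ((0 ∷ 3 ∷ 4 ∷ 11 ∷ 17 ∷ 12 ∷ 16 ∷ []) ∷ (1 ∷ 2 ∷ 6 ∷ 9 ∷ 7 ∷ 13 ∷ 8 ∷ []) ∷ (5 ∷ 19 ∷ 15 ∷ 10 ∷ 14 ∷ 18 ∷ 20 ∷ []) ∷ [])
  ∷ ((0 ∷ 2 ∷ 16 ∷ 19 ∷ 3 ∷ 17 ∷ 14 ∷ []) ∷ (1 ∷ 6 ∷ 15 ∷ 11 ∷ 12 ∷ 5 ∷ 4 ∷ []) ∷ (7 ∷ 8 ∷ 20 ∷ 9 ∷ 10 ∷ 13 ∷ 18 ∷ []) ∷ [])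
  ∷ ((0 ∷ 6 ∷ 4 ∷ 20 ∷ 14 ∷ 16 ∷ 15 ∷ []) ∷ (1 ∷ 11 ∷ 9 ∷ 8 ∷ 12 ∷ 13 ∷ 17 ∷ []) ∷ (2 ∷ 5 ∷ 3 ∷ 10 ∷ 7 ∷ 19 ∷ 18 ∷ []) ∷ [])
  ∷ ((0 ∷ 5 ∷ 6 ∷ 20 ∷ 16 ∷ 11 ∷ 13 ∷ []) ∷ (1 ∷ 3 ∷ 18 ∷ 17 ∷ 19 ∷ 14 ∷ 15 ∷ []) ∷ (2 ∷ 9 ∷ 12 ∷ 7 ∷ 4 ∷ 10 ∷ 8 ∷ []) ∷ [])
  ∷ []

triangles64 : Vec (Fin 7 × Fin 7) 6
triangles64 = (0 , 4) ∷ (1 , 3) ∷ (3 , 6) ∷ (4 , 2) ∷ (5 , 5) ∷ (6 , 0) ∷ []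

heptagons64 : Vec (Vec (Vec (Fin 21) 7) 3) 4
heptagons64 =
    ((0 ∷ 5 ∷ 6 ∷ 4 ∷ 2 ∷ 17 ∷ 15 ∷ []) ∷ (1 ∷ 3 ∷ 12 ∷ 10 ∷ 7 ∷ 20 ∷ 16 ∷ []) ∷ (8 ∷ 11 ∷ 9 ∷ 13 ∷ 19 ∷ 18 ∷ 14 ∷ []) ∷ [])
  ∷ ((0 ∷ 2 ∷ 6 ∷ 8 ∷ 9 ∷ 10 ∷ 1 ∷ []) ∷ (3 ∷ 18 ∷ 15 ∷ 16 ∷ 14 ∷ 20 ∷ 5 ∷ []) ∷ (4 ∷ 19 ∷ 17 ∷ 11 ∷ 12 ∷ 7 ∷ 13 ∷ []) ∷ [])
  ∷ ((0 ∷ 6 ∷ 14 ∷ 19 ∷ 20 ∷ 15 ∷ 9 ∷ []) ∷ (1 ∷ 5 ∷ 7 ∷ 11 ∷ 2 ∷ 3 ∷ 4 ∷ []) ∷ (8 ∷ 12 ∷ 18 ∷ 17 ∷ 16 ∷ 10 ∷ 13 ∷ []) ∷ [])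
  ∷ ((0 ∷ 4 ∷ 5 ∷ 2 ∷ 1 ∷ 6 ∷ 3 ∷ []) ∷ (7 ∷ 9 ∷ 12 ∷ 13 ∷ 11 ∷ 10 ∷ 8 ∷ []) ∷ (14 ∷ 17 ∷ 20 ∷ 18 ∷ 16 ∷ 19 ∷ 15 ∷ []) ∷ [])
  ∷ []

lemma5p1 : InHWP 21 3 7 2 8 × InHWP 21 3 7 4 6 × InHWP 21 3 7 6 4
lemma5p1 = checkedHWPFactorization (translatedTriangles triangles28) (cycleTable heptagons28)
         , checkedHWPFactorization (translatedTriangles triangles46) (cycleTable heptagons46)
         , checkedHWPFactorization (translatedTriangles triangles64) (cycleTable heptagons64)
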